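{- If $G$ is an average hereditary graph, then $\chi(G) \leq d(G) + 1$.
   Context: All graphs are finite, simple and undirected. The average degree of a graph $H$ is $d(H)=\frac{2|E(H)|}{|V(H)|}$ if $V(H)\neq\emptyset$ and $d(H)=0$ for the null graph. A graph $G$ is called average hereditary if for every induced subgraph $H$ of $G$ one has $d(H)\le d(G)$. $\chi(G)$ is the chromatic number of $G$. -}

module Defs where

open import Data.Nat using (ℕ; zero; suc; _+_; _*_)
open import Data.Bool using (Bool; true; false; _∧_)
import Data.Bool
open import Data.Fin using (Fin; _<_)
open import Data.Fin.Subset using (Subset; _∈_; ∣_∣)
open import Data.Vec using (lookup)
open import Data.List using (List; filter; length; allFin; concatMap; _∷_; [])
open import Data.Product using (_×_; _,_)
open import Relation.Binary.PropositionalEquality using (_≡_; _≢_)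
open import Relation.Nullary using (¬_; Dec; yes; no)
open import Data.Fin.Properties using (_<?_)
open import Data.Rational using (ℚ; _≤_; _/_; 0ℚ)
open import Data.Integer using (+_)

record Graph (n : ℕ) : Set where
  field
    adj   : Fin n → Fin n → Bool
    sym   : ∀ i j → adj i j ≡ adj j i
    irrefl : ∀ i → adj i i ≡ false
open Graph public

pairs : (n : ℕ) → List (Fin n × Fin n)
pairs n = concatMap (λ i → concatMap (λ j → lt i j) (allFin n)) (allFin n)
  where
  lt : Fin n → Fin n → List (Fin n × Fin n)
  lt i j with i <? j
  ... | yes _ = (i , j) ∷ []
  ... | no  _ = []

inducedEdges : ∀ {n} → Graph n → Subset n → ℕ
inducedEdges {n} G S =
  length (filter (λ p → Data.Bool._≟_ (edgeIn p) true) (pairs n))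
  where
  edgeIn : Fin n × Fin n → Bool
  edgeIn (i , j) = lookup S i ∧ lookup S j ∧ adj G i j

avgDeg : (e v : ℕ) → ℚ
avgDeg e zero = 0ℚ
avgDeg e (suc v) = (+ (2 * e)) / suc v

dInd : ∀ {n} → Graph n → Subset n → ℚ
dInd G S = avgDeg (inducedEdges G S) ∣ S ∣

d : ∀ {n} → Graph n → ℚ
d {n} G = avgDeg (inducedEdges G (Data.Fin.Subset.⊤)) n

AverageHereditary : ∀ {n} → Graph n → Set
AverageHereditary G = ∀ S → dInd G S ≤ d G

ProperColouring : ∀ {n} → Graph n → (k : ℕ) → (Fin n → Fin k) → Set
ProperColouring G k c = ∀ i j → adj G i j ≡ true → c i ≢ c j

-- χ(G) ≤ m  ⇔  G has a proper colouring with some k ≤ m colours;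
-- here m = d(G)+1 is rational, so we say: ∃ k with k ≤ d(G)+1 (in ℚ)

module Submission where

-- Every edge is counted twice in the degree sum, so average heredity applied to a nonempty vertex
-- set P says that the vertices of P have on average at most d(G) neighbours inside P. Some vertex
-- of P therefore has at most ⌊d(G)⌋ of them: G is ⌊d(G)⌋-degenerate. Greedy colouring (delete such
-- a vertex, colour the rest, give it a colour missed by its neighbours) uses ⌊d(G)⌋ + 1 colours.

open import Defs renaming (sym to adj-sym; irrefl to adj-irrefl)

-- ℕ arithmetic is opened only in here, so that _≤_, _+_ and _/_ in the final statement are ℚ's.
module _ where

  open import Data.Bool as Bool using (Bool; true; false; _∧_; if_then_else_)
  open import Data.Fin using (Fin; zero; suc)
  open import Data.Fin.Properties using (_≟_; _<?_; <-cmp; <-asym; any?; all?; ¬∀⟶∃¬)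
  import Data.Fin.Subset as Subset
  import Data.Integer as ℤ
  import Data.Integer.Properties as ℤ
  open import Data.Integer.Tactic.RingSolver using (solve-∀)
  open import Data.List using (List; []; _∷_; _++_; length; filter; concatMap; allFin; tabulate)
  open import Data.List.Properties using (filter-++; length-++)
  open import Data.Nat as ℕ using (ℕ; zero; suc; _+_; _*_; _≤_; _<_; z≤n; s≤s)
  open import Data.Nat.DivMod using (m/n*n≤m; m*n/n≡m; /-monoˡ-≤)
  open import Data.Nat.Properties hiding (_≟_; _<?_; <-cmp; <-asym)
  open import Data.Product using (Σ; ∃-syntax; _×_; _,_)
  open import Data.Rational as ℚ using (_/_; 1ℚ; toℚᵘ)
  open import Data.Rational.Properties
    using (toℚᵘ-mono-≤; toℚᵘ-cancel-≤; toℚᵘ-fromℚᵘ; toℚᵘ-homo-+; toℚᵘ-injective)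
  open import Data.Rational.Unnormalised as ℚᵘ using (mkℚᵘ; *≤*; *≡*)
  import Data.Rational.Unnormalised.Properties as ℚᵘ
  open import Data.Vec using (lookup) renaming (tabulate to tabulateᵛ)
  open import Data.Vec.Properties using (lookup∘tabulate)
  open import Function using (_∘_; id)
  open import Relation.Binary.Definitions using (tri<; tri≈; tri>)
  open import Relation.Binary.PropositionalEquality
  open import Relation.Nullary using (Dec; does; yes; no; contradiction)
  open import Relation.Nullary.Decidable using (dec-true; _×-dec_)
  open import Relation.Unary using (Pred; Decidable)

  open import Algebra.Properties.Semiring.Sum +-*-semiring
    using ( sum; sum-syntax; sum-cong-≗; sum-replicate-zero; ∑-distrib-+; ∑-comm
          ; *-distribˡ-sum; *-distribʳ-sum)

  𝟙 : Bool → ℕ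
  𝟙 true = 1
  𝟙 false = 0

  𝟙-∧ : ∀ a b → 𝟙 (a ∧ b) ≡ 𝟙 a * 𝟙 b
  𝟙-∧ true b = sym (+-identityʳ (𝟙 b))
  𝟙-∧ false b = refl

  count : ∀ {n} → (Fin n → Bool) → ℕ
  count {n} P = ∑[ i < n ] 𝟙 (P i)

  sum-mono-≤ : ∀ {n} {f g : Fin n → ℕ} → (∀ i → f i ≤ g i) → sum f ≤ sum g
  sum-mono-≤ {zero} f≤g = z≤n
  sum-mono-≤ {suc n} f≤g = +-mono-≤ (f≤g zero) (sum-mono-≤ (f≤g ∘ suc))

  term≤sum : ∀ {n} (f : Fin n → ℕ) i → f i ≤ sum f
  term≤sum f zero = m≤m+n _ _
  term≤sum f (suc i) = ≤-trans (term≤sum (f ∘ suc) i) (m≤n+m _ _)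

  sum-const : ∀ n c → ∑[ i < n ] c ≡ n * c
  sum-const zero c = refl
  sum-const (suc n) c = cong (c +_) (sum-const n c)

  sum-𝟙-≟ : ∀ {n} (y : Fin n) → ∑[ x < n ] 𝟙 (does (y ≟ x)) ≡ 1
  sum-𝟙-≟ {suc n} zero = cong suc (sum-replicate-zero n)
  sum-𝟙-≟ {suc n} (suc y) = sum-𝟙-≟ y

  member⇒1≤count : ∀ {n} (P : Fin n → Bool) {v} → P v ≡ true → 1 ≤ count P
  member⇒1≤count P {v} Pv = subst (λ b → 𝟙 b ≤ count P) Pv (term≤sum (𝟙 ∘ P) v)

  ∃-≤-average : ∀ {n} (P : Fin n → Bool) (f : Fin n → ℕ) c {v} → P v ≡ true →
    ∑[ i < n ] (𝟙 (P i) * f i) ≤ count P * c → ∃[ i ] (P i ≡ true × f i ≤ c)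
  ∃-≤-average P f c Pv bound with any? (λ i → (P i Bool.≟ true) ×-dec (f i ℕ.≤? c))
  ... | yes found = found
  ... | no none = contradiction bound (<⇒≱ (begin-strict
    count P * c                   <⟨ *-monoʳ-< (count P) ⦃ ℕ.>-nonZero (member⇒1≤count P Pv) ⦄ ≤-refl ⟩
    count P * suc c               ≡⟨ *-distribʳ-sum (suc c) (𝟙 ∘ P) ⟩
    ∑[ i < _ ] (𝟙 (P i) * suc c)  ≤⟨ sum-mono-≤ above ⟩
    ∑[ i < _ ] (𝟙 (P i) * f i)    ∎))
    where
    open ≤-Reasoning
    above : ∀ i → 𝟙 (P i) * suc c ≤ 𝟙 (P i) * f i
    above i with P i in Pi
    ... | false = z≤n
    ... | true = *-monoʳ-≤ 1 (≰⇒> (λ fi≤c → none (i , Pi , fi≤c)))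

  cover⇒≤count : ∀ {n k} (N : Fin n → Bool) (c : Fin n → Fin k) →
    (∀ x → ∃[ j ] (N j ≡ true × c j ≡ x)) → k ≤ count N
  cover⇒≤count {n} {k} N c cover = begin
    k                                 ≡⟨ sym (trans (sum-const k 1) (*-identityʳ k)) ⟩
    ∑[ x < k ] 1                      ≤⟨ sum-mono-≤ hit ⟩
    ∑[ x < k ] ∑[ j < n ] hits j x    ≡⟨ ∑-comm (λ x j → hits j x) ⟩
    ∑[ j < n ] ∑[ x < k ] hits j x    ≡⟨ sum-cong-≗ hit-once ⟩
    count N                           ∎
    where
    open ≤-Reasoning
    hits : Fin n → Fin k → ℕ
    hits j x = 𝟙 (N j) * 𝟙 (does (c j ≟ x))

    hit : ∀ x → 1 ≤ ∑[ j < n ] hits j x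
    hit x with cover x
    ... | j , Nj , refl =
      ≤-trans (≤-reflexive (sym (cong₂ (λ a b → 𝟙 a * 𝟙 b) Nj (dec-true (c j ≟ c j) refl))))
              (term≤sum (λ j′ → hits j′ (c j)) j)

    hit-once : ∀ j → ∑[ x < k ] hits j x ≡ 𝟙 (N j)
    hit-once j = trans (sym (*-distribˡ-sum (𝟙 (N j)) (λ x → 𝟙 (does (c j ≟ x)))))
                       (trans (cong (𝟙 (N j) *_) (sum-𝟙-≟ (c j))) (*-identityʳ (𝟙 (N j))))

  unused-colour : ∀ {n k} (N : Fin n → Bool) (c : Fin n → Fin k) → count N < k →
    ∃[ x ] (∀ j → N j ≡ true → c j ≢ x)
  unused-colour {k = k} N c few = pick (all? used?)
    where
    used? : Decidable (λ x → ∃[ j ] (N j ≡ true × c j ≡ x))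
    used? x = any? (λ j → (N j Bool.≟ true) ×-dec (c j ≟ x))

    pick : Dec (∀ x → ∃[ j ] (N j ≡ true × c j ≡ x)) → ∃[ x ] (∀ j → N j ≡ true → c j ≢ x)
    pick (yes cover) = contradiction (cover⇒≤count N c cover) (<⇒≱ few)
    pick (no ¬cover) =
      let x , unused = ¬∀⟶∃¬ k _ used? ¬cover
      in x , λ j Nj cj≡x → unused (j , Nj , cj≡x)

  _∖_ : ∀ {n} → (Fin n → Bool) → Fin n → Fin n → Bool
  (P ∖ w) i = if does (w ≟ i) then false else P i

  count-∖ : ∀ {n} (P : Fin n → Bool) {w} → P w ≡ true → count P ≡ suc (count (P ∖ w))
  count-∖ {n} P {w} Pw = begin
    count P
      ≡⟨ sum-cong-≗ split ⟩
    ∑[ i < n ] (𝟙 (does (w ≟ i)) + 𝟙 ((P ∖ w) i))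
      ≡⟨ ∑-distrib-+ (λ i → 𝟙 (does (w ≟ i))) (λ i → 𝟙 ((P ∖ w) i)) ⟩
    ∑[ i < n ] 𝟙 (does (w ≟ i)) + count (P ∖ w)
      ≡⟨ cong (_+ count (P ∖ w)) (sum-𝟙-≟ w) ⟩
    suc (count (P ∖ w)) ∎
    where
    open ≡-Reasoning
    split : ∀ i → 𝟙 (P i) ≡ 𝟙 (does (w ≟ i)) + 𝟙 ((P ∖ w) i)
    split i with w ≟ i
    ... | yes refl = cong 𝟙 Pw
    ... | no _     = refl

  ∈-∖ : ∀ {n} (P : Fin n → Bool) {w i} → w ≢ i → P i ≡ true → (P ∖ w) i ≡ true
  ∈-∖ P {w} {i} w≢i Pi with w ≟ i
  ... | yes w≡i = contradiction w≡i w≢i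
  ... | no _    = Pi

  -- Defined by `with` rather than `if does (i <? j)`, so that `with i <? j` abstracts it, as in `pairs`.
  upper : ∀ {n} → (Fin n → Fin n → ℕ) → Fin n → Fin n → ℕ
  upper f i j with i <? j
  ... | yes _ = f i j
  ... | no _  = 0

  upper-split : ∀ {n} (f : Fin n → Fin n → ℕ) →
    (∀ i j → f i j ≡ f j i) → (∀ i → f i i ≡ 0) →
    ∀ i j → f i j ≡ upper f i j + upper f j i
  upper-split f f-sym f-diag i j with i <? j | j <? i
  ... | yes i<j | yes j<i = contradiction j<i (<-asym i<j)
  ... | yes _   | no _    = sym (+-identityʳ (f i j))
  ... | no _    | yes _   = f-sym i j
  ... | no i≮j  | no j≮i with <-cmp i j
  ...   | tri< i<j _ _ = contradiction i<j i≮j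
  ...   | tri≈ _ refl _ = f-diag i
  ...   | tri> _ _ j<i = contradiction j<i j≮i

  sum²-symmetric : ∀ {n} (f : Fin n → Fin n → ℕ) →
    (∀ i j → f i j ≡ f j i) → (∀ i → f i i ≡ 0) →
    ∑[ i < n ] ∑[ j < n ] f i j ≡ 2 * ∑[ i < n ] ∑[ j < n ] upper f i j
  sum²-symmetric {n} f f-sym f-diag = begin
    ∑[ i < n ] ∑[ j < n ] f i j
      ≡⟨ sum-cong-≗ (λ i → trans (sum-cong-≗ (upper-split f f-sym f-diag i))
                                 (∑-distrib-+ (upper f i) (λ j → upper f j i))) ⟩
    ∑[ i < n ] (∑[ j < n ] upper f i j + ∑[ j < n ] upper f j i)
      ≡⟨ ∑-distrib-+ (λ i → ∑[ j < n ] upper f i j) (λ i → ∑[ j < n ] upper f j i) ⟩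
    U + ∑[ i < n ] ∑[ j < n ] upper f j i
      ≡⟨ cong (U +_) (∑-comm (λ i j → upper f j i)) ⟩
    U + U
      ≡⟨ cong (U +_) (sym (+-identityʳ U)) ⟩
    2 * U ∎
    where
    open ≡-Reasoning
    U = ∑[ i < n ] ∑[ j < n ] upper f i j

  length-filter-concatMap-tabulate : ∀ {n ℓ} {A B : Set} {Q : Pred B ℓ} (Q? : Decidable Q)
    (f : A → List B) (g : Fin n → A) →
    length (filter Q? (concatMap f (tabulate g))) ≡ ∑[ i < n ] length (filter Q? (f (g i)))
  length-filter-concatMap-tabulate {zero} Q? f g = refl
  length-filter-concatMap-tabulate {suc n} Q? f g = begin
    length (filter Q? (f (g zero) ++ concatMap f (tabulate (g ∘ suc))))
      ≡⟨ cong length (filter-++ Q? (f (g zero)) _) ⟩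
    length (filter Q? (f (g zero)) ++ filter Q? (concatMap f (tabulate (g ∘ suc))))
      ≡⟨ length-++ (filter Q? (f (g zero))) ⟩
    length (filter Q? (f (g zero))) + length (filter Q? (concatMap f (tabulate (g ∘ suc))))
      ≡⟨ cong (length (filter Q? (f (g zero))) +_) (length-filter-concatMap-tabulate Q? f (g ∘ suc)) ⟩
    ∑[ i < suc n ] length (filter Q? (f (g i))) ∎
    where open ≡-Reasoning

  length-filter-singleton : ∀ {B : Set} (b : B → Bool) x →
    length (filter (λ y → b y Bool.≟ true) (x ∷ [])) ≡ 𝟙 (b x)
  length-filter-singleton b x with b x
  ... | true  = refl
  ... | false = refl

  ∣tabulate∣≡count : ∀ {n} (P : Fin n → Bool) → Subset.∣ tabulateᵛ P ∣ ≡ count P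
  ∣tabulate∣≡count {zero} P = refl
  ∣tabulate∣≡count {suc n} P with P zero
  ... | true  = cong suc (∣tabulate∣≡count (P ∘ suc))
  ... | false = ∣tabulate∣≡count (P ∘ suc)

  -- `pairs` lists its cells through a local helper of Defs; unifying against the
  -- unfolding of `pairs` gives that helper a name here.
  pairsCell : ∀ n → Fin n → Fin n → List (Fin n × Fin n)
  pairsCell n = cellOf refl
    where
    cellOf : ∀ {L : Fin n → Fin n → List (Fin n × Fin n)} →
      pairs n ≡ concatMap (λ i → concatMap (L i) (allFin n)) (allFin n) →
      Fin n → Fin n → List (Fin n × Fin n)
    cellOf {L} _ = L

  module _ {n} (G : Graph n) where

    edge : (Fin n → Bool) → Fin n → Fin n → ℕ
    edge P i j = 𝟙 (P i ∧ P j ∧ adj G i j)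

    edges : (Fin n → Bool) → ℕ
    edges P = ∑[ i < n ] ∑[ j < n ] upper (edge P) i j

    degree : (Fin n → Bool) → Fin n → ℕ
    degree P v = ∑[ j < n ] 𝟙 (P j ∧ adj G v j)

    edge-sym : ∀ P i j → edge P i j ≡ edge P j i
    edge-sym P i j rewrite adj-sym G i j with P i | P j
    ... | true  | true  = refl
    ... | true  | false = refl
    ... | false | true  = refl
    ... | false | false = refl

    edge-diag : ∀ P i → edge P i i ≡ 0
    edge-diag P i rewrite adj-irrefl G i with P i
    ... | true  = refl
    ... | false = refl

    handshake : ∀ P → ∑[ i < n ] (𝟙 (P i) * degree P i) ≡ 2 * edges P
    handshake P = begin
      ∑[ i < n ] (𝟙 (P i) * degree P i)
        ≡⟨ sum-cong-≗ (λ i → trans (*-distribˡ-sum (𝟙 (P i)) (λ j → 𝟙 (P j ∧ adj G i j)))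
                                   (sum-cong-≗ λ j → sym (𝟙-∧ (P i) (P j ∧ adj G i j)))) ⟩
      ∑[ i < n ] ∑[ j < n ] edge P i j
        ≡⟨ sum²-symmetric (edge P) (edge-sym P) (edge-diag P) ⟩
      2 * edges P ∎
      where open ≡-Reasoning

    edgeIn : Subset.Subset n → Fin n × Fin n → Bool
    edgeIn S (i , j) = lookup S i ∧ lookup S j ∧ adj G i j

    inducedEdges-tabulate : ∀ P → inducedEdges G (tabulateᵛ P) ≡ edges P
    inducedEdges-tabulate P = begin
      inducedEdges G (tabulateᵛ P)
        ≡⟨ length-filter-concatMap-tabulate inP? (λ i → concatMap (pairsCell n i) (allFin n)) id ⟩
      ∑[ i < n ] length (filter inP? (concatMap (pairsCell n i) (allFin n)))
        ≡⟨ sum-cong-≗ (λ i → length-filter-concatMap-tabulate inP? (pairsCell n i) id) ⟩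
      ∑[ i < n ] ∑[ j < n ] length (filter inP? (pairsCell n i j))
        ≡⟨ sum-cong-≗ (λ i → sum-cong-≗ (cell i)) ⟩
      edges P ∎
      where
      open ≡-Reasoning
      inP? : Decidable (λ p → edgeIn (tabulateᵛ P) p ≡ true)
      inP? p = edgeIn (tabulateᵛ P) p Bool.≟ true
      cell : ∀ i j → length (filter inP? (pairsCell n i j)) ≡ upper (edge P) i j
      cell i j with i <? j
      ... | no _ = refl
      ... | yes _ = trans (length-filter-singleton (edgeIn (tabulateᵛ P)) (i , j))
        (cong₂ (λ a b → 𝟙 (a ∧ b ∧ adj G i j)) (lookup∘tabulate P i) (lookup∘tabulate P j))

    Degenerate : ℕ → Set
    Degenerate D = ∀ P {v} → P v ≡ true → ∃[ w ] (P w ≡ true × degree P w ≤ D)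

    ProperOn : ∀ {k} → (Fin n → Bool) → (Fin n → Fin k) → Set
    ProperOn P c = ∀ i j → P i ≡ true → P j ≡ true → adj G i j ≡ true → c i ≢ c j

    recolour-proper : ∀ {k} P {w} (c : Fin n → Fin k) x → ProperOn (P ∖ w) c →
      (∀ j → P j ∧ adj G w j ≡ true → c j ≢ x) →
      ProperOn P (λ i → if does (w ≟ i) then x else c i)
    recolour-proper P {w} c x proper x-free i j Pi Pj i~j with w ≟ i | w ≟ j
    ... | yes refl | yes refl = contradiction (trans (sym (adj-irrefl G i)) i~j) λ ()
    ... | yes refl | no w≢j = x-free j (subst (λ b → b ∧ adj G w j ≡ true) (sym Pj) i~j) ∘ sym
    ... | no w≢i | yes refl =
      x-free i (subst (λ b → b ∧ adj G w i ≡ true) (sym Pi) (trans (adj-sym G w i) i~j))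
    ... | no w≢i | no w≢j = proper i j (∈-∖ P w≢i Pi) (∈-∖ P w≢j Pj) i~j

    degenerate⇒colourableOn : ∀ {D} → Degenerate D → ∀ t P → count P ≤ t →
      Σ (Fin n → Fin (suc D)) (ProperOn P)
    degenerate⇒colourableOn degenerate zero P count≤0 =
      (λ _ → zero) , λ i _ Pi _ _ _ → contradiction count≤0 (<⇒≱ (member⇒1≤count P Pi))
    degenerate⇒colourableOn degenerate (suc t) P ≤suc-t with any? (λ v → P v Bool.≟ true)
    ... | no empty = (λ _ → zero) , λ i _ Pi _ _ _ → empty (i , Pi)
    ... | yes (v , Pv) with degenerate P Pv
    ...   | w , Pw , deg≤D with degenerate⇒colourableOn degenerate t (P ∖ w)
                                  (≤-pred (subst (_≤ suc t) (count-∖ P Pw) ≤suc-t))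
    ...     | c , proper with unused-colour (λ j → P j ∧ adj G w j) c (s≤s deg≤D)
    ...       | x , x-free = _ , recolour-proper P c x proper x-free

    degenerate⇒colourable : ∀ {D} → Degenerate D → Σ (Fin n → Fin (suc D)) (ProperColouring G (suc D))
    degenerate⇒colourable degenerate =
      let c , proper = degenerate⇒colourableOn degenerate n (λ _ → true)
                         (≤-reflexive (trans (sum-const n 1) (*-identityʳ n)))
      in c , λ i j → proper i j refl refl

  toℚᵘ-/ : ∀ a b → toℚᵘ ((ℤ.+ a) / suc b) ℚᵘ.≃ mkℚᵘ (ℤ.+ a) b
  toℚᵘ-/ a b = toℚᵘ-fromℚᵘ (mkℚᵘ (ℤ.+ a) b)

  /≤/⇒*≤* : ∀ a b c d → (ℤ.+ a) / suc b ℚ.≤ (ℤ.+ c) / suc d → a * suc d ≤ c * suc b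
  /≤/⇒*≤* a b c d a/b≤c/d
    with ℚᵘ.≤-respʳ-≃ (toℚᵘ-/ c d) (ℚᵘ.≤-respˡ-≃ (toℚᵘ-/ a b) (toℚᵘ-mono-≤ a/b≤c/d))
  ... | *≤* ad≤cb =
    ℤ.drop‿+≤+ (subst₂ ℤ._≤_ (sym (ℤ.pos-* a (suc d))) (sym (ℤ.pos-* c (suc b))) ad≤cb)

  *≤*⇒/≤/ : ∀ a b c d → a * suc d ≤ c * suc b → (ℤ.+ a) / suc b ℚ.≤ (ℤ.+ c) / suc d
  *≤*⇒/≤/ a b c d ad≤cb = toℚᵘ-cancel-≤
    (ℚᵘ.≤-respʳ-≃ (ℚᵘ.≃-sym (toℚᵘ-/ c d))
      (ℚᵘ.≤-respˡ-≃ (ℚᵘ.≃-sym (toℚᵘ-/ a b))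
        (*≤* (subst₂ ℤ._≤_ (ℤ.pos-* a (suc d)) (ℤ.pos-* c (suc b)) (ℤ.+≤+ ad≤cb)))))

  /-+-1ℚ : ∀ c d → (ℤ.+ c) / suc d ℚ.+ 1ℚ ≡ (ℤ.+ (c + suc d)) / suc d
  /-+-1ℚ c d = toℚᵘ-injective (begin
    toℚᵘ ((ℤ.+ c) / suc d ℚ.+ 1ℚ)
      ≈⟨ toℚᵘ-homo-+ ((ℤ.+ c) / suc d) 1ℚ ⟩
    toℚᵘ ((ℤ.+ c) / suc d) ℚᵘ.+ mkℚᵘ (ℤ.+ 1) 0
      ≈⟨ ℚᵘ.+-congˡ (mkℚᵘ (ℤ.+ 1) 0) (toℚᵘ-/ c d) ⟩
    mkℚᵘ (ℤ.+ c) d ℚᵘ.+ mkℚᵘ (ℤ.+ 1) 0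
      ≈⟨ *≡* (cross-multiplied (ℤ.+ c) (ℤ.+ suc d)) ⟩
    mkℚᵘ (ℤ.+ (c + suc d)) d
      ≈⟨ ℚᵘ.≃-sym (toℚᵘ-/ (c + suc d) d) ⟩
    toℚᵘ ((ℤ.+ (c + suc d)) / suc d) ∎)
    where
    open ℚᵘ.≃-Reasoning
    cross-multiplied : ∀ x y →
      (x ℤ.* ℤ.1ℤ ℤ.+ ℤ.1ℤ ℤ.* y) ℤ.* y ≡ (x ℤ.+ y) ℤ.* (y ℤ.* ℤ.1ℤ)
    cross-multiplied = solve-∀

  suc-⌊/⌋≤/+1 : ∀ c d → (ℤ.+ suc (c ℕ./ suc d)) / 1 ℚ.≤ (ℤ.+ c) / suc d ℚ.+ 1ℚ
  suc-⌊/⌋≤/+1 c d rewrite /-+-1ℚ c d = *≤*⇒/≤/ (suc (c ℕ./ suc d)) 0 (c + suc d) d (begin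
    suc (c ℕ./ suc d) * suc d     ≡⟨ +-comm (suc d) (c ℕ./ suc d * suc d) ⟩
    c ℕ./ suc d * suc d + suc d   ≤⟨ +-monoˡ-≤ (suc d) (m/n*n≤m c (suc d)) ⟩
    c + suc d                     ≡⟨ sym (*-identityʳ (c + suc d)) ⟩
    (c + suc d) * 1               ∎)
    where open ≤-Reasoning

  *≤⇒≤/ : ∀ a b c → a * suc b ≤ c → a ≤ c ℕ./ suc b
  *≤⇒≤/ a b c ab≤c = subst (_≤ c ℕ./ suc b) (m*n/n≡m a (suc b)) (/-monoˡ-≤ (suc b) ab≤c)

  avgDeg-≤⇒*≤* : ∀ a v c u → 1 ≤ v →
    avgDeg a v ℚ.≤ avgDeg c (suc u) → 2 * a * suc u ≤ 2 * c * v
  avgDeg-≤⇒*≤* a (suc b) c u _ = /≤/⇒*≤* (2 * a) b (2 * c) u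

  module _ {m} (G : Graph (suc m)) (hereditary : AverageHereditary G) where

    edge-density : ∀ P {v} → P v ≡ true → 2 * edges G P * suc m ≤ 2 * inducedEdges G Subset.⊤ * count P
    edge-density P Pv =
      avgDeg-≤⇒*≤* (edges G P) (count P) (inducedEdges G Subset.⊤) m (member⇒1≤count P Pv)
        (subst₂ (λ e v → avgDeg e v ℚ.≤ d G) (inducedEdges-tabulate G P) (∣tabulate∣≡count P)
          (hereditary (tabulateᵛ P)))

    hereditary⇒degenerate : Degenerate G (2 * inducedEdges G Subset.⊤ ℕ./ suc m)
    hereditary⇒degenerate P Pv =
      let w , Pw , deg*n≤2e =
            ∃-≤-average P (λ i → degree G P i * suc m) (2 * inducedEdges G Subset.⊤) Pv mean-bound
      in w , Pw , *≤⇒≤/ (degree G P w) m (2 * inducedEdges G Subset.⊤) deg*n≤2e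
      where
      open ≤-Reasoning
      mean-bound :
        ∑[ i < suc m ] (𝟙 (P i) * (degree G P i * suc m)) ≤ count P * (2 * inducedEdges G Subset.⊤)
      mean-bound = begin
        ∑[ i < suc m ] (𝟙 (P i) * (degree G P i * suc m))
          ≡⟨ sum-cong-≗ (λ i → sym (*-assoc (𝟙 (P i)) (degree G P i) (suc m))) ⟩
        ∑[ i < suc m ] (𝟙 (P i) * degree G P i * suc m)
          ≡⟨ sym (*-distribʳ-sum (suc m) (λ i → 𝟙 (P i) * degree G P i)) ⟩
        ∑[ i < suc m ] (𝟙 (P i) * degree G P i) * suc m
          ≡⟨ cong (_* suc m) (handshake G P) ⟩
        2 * edges G P * suc m
          ≤⟨ edge-density P Pv ⟩
        2 * inducedEdges G Subset.⊤ * count P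
          ≡⟨ *-comm (2 * inducedEdges G Subset.⊤) (count P) ⟩
        count P * (2 * inducedEdges G Subset.⊤) ∎

open import Data.Nat using (ℕ; zero; suc; _*_)
open import Data.Fin using (Fin)
import Data.Fin.Subset as Subset
open import Data.Product using (Σ; _×_; _,_)
open import Data.Integer using (+_)
open import Data.Rational using (_≤_; _+_; 1ℚ; _/_)

corollary1 : ∀ {n} (G : Graph n) → AverageHereditary G →
    Σ ℕ (λ k → Σ (Fin n → Fin k) (λ c →
    ProperColouring G k c × ((+ k) / 1) ≤ d G + 1ℚ))
corollary1 {zero} G hereditary = 1 , (λ ()) , (λ ()) , suc-⌊/⌋≤/+1 0 0
corollary1 {suc m} G hereditary =
  let c , proper = degenerate⇒colourable G (hereditary⇒degenerate G hereditary)
  in _ , c , proper , suc-⌊/⌋≤/+1 (2 * inducedEdges G Subset.⊤) m
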